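{- Let $n\ge 1$, let $q$ be a prime power, let $U\subseteq\mathbb{F}_q^{\,n}$ be a linear subspace with $\dim U<n$, and let $\mathcal{D}$ be a set of $1$-dimensional linear subspaces of $\mathbb{F}_q^{\,n}$ each contained in $U$. Suppose the set of affine lines $\bigsqcup_{\ell\in\mathcal{D}}\mathcal{L}_U(\ell)$ admits a universal cycle $\mathcal{C}_U$. Then the set of affine lines $\bigsqcup_{\ell\in\mathcal{D}}\mathcal{L}(\ell)$ in $\mathbb{F}_q^{\,n}$ admits a universal cycle $\mathcal{C}$. Moreover, if $\mathcal{C}_U$ contains the vertex $0$, then $\mathcal{C}$ also contains the vertex $0$.
   Context: Affine lines of $\mathbb{F}_q^{\,n}$ are the sets $x+\ell$ with $x\in\mathbb{F}_q^{\,n}$ and $\ell$ a $1$-dimensional linear subspace (the direction). For a $1$-dimensional subspace $\ell$, $\mathcal{L}(\ell)=\{x+\ell: x\in\mathbb{F}_q^{\,n}\}$ is the set of all affine lines with direction $\ell$, and for $\ell\subseteq U$, $\mathcal{L}_U(\ell)=\{x+\ell: x\in U\}$ is the set of affine lines contained in $U$ with direction $\ell$. The projective completion $\mathrm{PG}(n,q)$ consists of the affine points $x\in\mathbb{F}_q^{\,n}$ and the points at infinity $[\ell]$, one for each $1$-dimensional subspace $\ell$. A window $(p,p')$ of two points of $\mathrm{PG}(n,q)$ represents an affine line as follows: if $p,p'$ are distinct affine points, the line through them; if one is an affine point $x$ and the other is $[\ell]$, the line $x+\ell$; otherwise it represents no affine line. Given a set $\mathcal{F}$ of affine lines, a universal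 cycle for $\mathcal{F}$ is a cyclic sequence $(p_i)_{i\in\mathbb{Z}/N\mathbb{Z}}$ of points of $\mathrm{PG}(n,q)$ such that every window $(p_i,p_{i+1})$ represents an affine line, the lines represented by the $N$ windows are pairwise distinct, and the set of lines represented is exactly $\mathcal{F}$. A cycle contains the vertex $0$ if $p_i=0$ for some $i$. -}

module Defs where

open import Level using (0ℓ)
open import Data.Nat using (ℕ; zero; suc; _<_; _^_)
open import Data.Nat.DivMod using (_mod_)
open import Data.Nat.Primality using (Prime)
open import Data.Fin using (Fin; toℕ)
open import Data.Vec using (Vec; []; _∷_; replicate; zipWith; map)
open import Data.Product using (Σ; ∃; _×_; _,_)
open import Relation.Binary.PropositionalEquality using (_≡_; _≢_)
open import Algebra.Structures using (IsCommutativeRing)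
open import Function.Bundles using (_↔_)

IsPrimePower : ℕ → Set
IsPrimePower q = Σ ℕ λ p → Σ ℕ λ k → Prime p × q ≡ p ^ suc k

record FiniteField (q : ℕ) : Set₁ where
  field
    Carrier : Set
    _+_ _*_ : Carrier → Carrier → Carrier
    -_      : Carrier → Carrier
    0# 1#   : Carrier
    isCommutativeRing : IsCommutativeRing {A = Carrier} _≡_ _+_ _*_ -_ 0# 1#
    0≢1     : 0# ≢ 1#
    inverse : ∀ x → x ≢ 0# → Σ Carrier λ y → x * y ≡ 1#
    card    : Carrier ↔ Fin q

module _ {q : ℕ} (𝔽 : FiniteField q) (n : ℕ) where
  open FiniteField 𝔽

  Pt : Set
  Pt = Vec Carrier n

  0v : Pt
  0v = replicate n 0#

  _+v_ : Pt → Pt → Pt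
  _+v_ = zipWith _+_

  _-v_ : Pt → Pt → Pt
  x -v y = zipWith _+_ x (map -_ y)

  _·v_ : Carrier → Pt → Pt
  c ·v x = map (c *_) x

  lincomb : ∀ {k} → Vec Carrier k → Vec Pt k → Pt
  lincomb []       []       = 0v
  lincomb (c ∷ cs) (b ∷ bs) = (c ·v b) +v lincomb cs bs

  record IsSubspace (U : Pt → Set) : Set where
    field
      zero∈ : U 0v
      +-closed : ∀ x y → U x → U y → U (x +v y)
      ·-closed : ∀ c x → U x → U (c ·v x)

  HasDim : (Pt → Set) → ℕ → Set
  HasDim U k = Σ (Vec Pt k) λ b →
      (∀ (c : Vec Carrier k) → lincomb c b ≡ 0v → c ≡ replicate k 0#)
    × (∀ x → (U x → Σ (Vec Carrier k) λ c → lincomb c b ≡ x)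
           × ((Σ (Vec Carrier k) λ c → lincomb c b ≡ x) → U x))

  DimLess : (Pt → Set) → Set
  DimLess U = Σ ℕ λ k → k < n × HasDim U k

  -- A nonzero vector v; it stands for the 1-dimensional subspace ℓ = span v.
  Dir : Set
  Dir = Σ Pt λ v → v ≢ 0v

  SpanIn : Dir → (Pt → Set) → Set
  SpanIn (v , _) U = ∀ c → U (c ·v v)

  record Line : Set where
    constructor mkLine
    field
      base : Pt
      dir  : Dir

  _∈L_ : Pt → Line → Set
  z ∈L mkLine x (v , _) = Σ Carrier λ c → z ≡ x +v (c ·v v)

  _≐S_ : Line → (Pt → Set) → Set
  L ≐S S = ∀ z → (z ∈L L → S z) × (S z → z ∈L L)

  _≐_ : Line → Line → Set
  L ≐ L' = L ≐S (λ z → z ∈L L')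

  -- points of PG(n,q): affine points and points at infinity [span v]
  data PGPoint : Set where
    aff : Pt → PGPoint
    inf : Dir → PGPoint

  data Represents : PGPoint → PGPoint → Line → Set where
    aa : ∀ {x y L} → x ≢ y
         → L ≐S (λ z → Σ Carrier λ c → z ≡ x +v (c ·v (y -v x)))
         → Represents (aff x) (aff y) L
    ai : ∀ {x d L} → L ≐ mkLine x d → Represents (aff x) (inf d) L
    ia : ∀ {x d L} → L ≐ mkLine x d → Represents (inf d) (aff x) L

  next : ∀ {N} → Fin N → Fin N
  next {suc m} i = suc (toℕ i) mod suc m

  record UniversalCycle (𝓕 : Line → Set) : Set where
    field
      N      : ℕ
      p      : Fin N → PGPoint
      line   : Fin N → Line
      rep    : ∀ i → Represents (p i) (p (next i)) (line i)
      distinct : ∀ i j → line i ≐ line j → i ≡ j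
      inFam  : ∀ i → 𝓕 (line i)
      covers : ∀ L → 𝓕 L → Σ (Fin N) λ i → line i ≐ L

  ContainsZero : ∀ {𝓕} → UniversalCycle 𝓕 → Set
  ContainsZero C = Σ (Fin N) λ i → p i ≡ aff 0v
    where open UniversalCycle C

  -- ⊔_{ℓ ∈ D} 𝓛_U(ℓ) : lines x + ℓ with x ∈ U, ℓ ∈ D
  LinesIn : (Pt → Set) → (Dir → Set) → Line → Set
  LinesIn U D L = Σ Pt λ x → Σ Dir λ d → D d × U x × L ≐ mkLine x d

  -- ⊔_{ℓ ∈ D} 𝓛(ℓ) : lines x + ℓ with x ∈ 𝔽_q^n, ℓ ∈ D
  AllLines : (Dir → Set) → Line → Set
  AllLines D L = Σ Pt λ x → Σ Dir λ d → D d × L ≐ mkLine x d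

{-# OPTIONS --safe #-}
module Submission where

-- The lines with direction in D are partitioned according to the cosets t + U, and the lines lying in t + U
-- are exactly the translates by t of the lines of C_U. So it suffices to chain together translated copies of
-- C_U, one for each coset representative t; a window (x, x′) and its translate (x + t, x′ + t) represent
-- translated lines.
--
-- If C_U visits a point at infinity, every copy visits that same point, and the copies are concatenated
-- there. Otherwise C_U is a cycle of affine points A₀ … A_{N-1}. A window joining an affine point to the
-- point at infinity of a line through it represents that line, so replacing A₀ by the point at infinity of
-- line 0, and ending at the point at infinity of line N-1 instead of returning to A₀, turns a copy into a
-- path between two points at infinity; running a copy backwards gives a path in the other direction, and
-- copies are chained in forward/backward pairs. An odd number of cosets needs one gadget made of three
-- copies. Affine cycles of length 1 or 2 do not exist.
--
-- Choosing −A₁ (for a suitable rotation of C_U) as the representative of U makes the copy of A₁ the origin,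
-- so the constructed cycle passes through 0 as soon as C_U is nonempty.

open import Algebra.Bundles using (AbelianGroup; CommutativeRing)
open import Algebra.Structures using (IsAbelianGroup)
import Algebra.Properties.AbelianGroup as AbelianGroupProperties
import Algebra.Properties.CommutativeSemigroup as CommutativeSemigroupProperties
import Algebra.Properties.Ring as RingProperties
open import Data.Empty using (⊥-elim)
open import Data.Fin.Base using (Fin; zero; suc; toℕ; fromℕ; inject₁)
import Data.Fin.Properties as Finₚ
open import Data.List.Base
  using (List; []; _∷_; [_]; _++_; _∷ʳ_; map; length; lookup; tabulate; reverse; allFin; filter; deduplicate;
         cartesianProduct; cartesianProductWith; initLast; _∷ʳ′_)
import Data.List.Properties as Listₚ
open import Data.List.Membership.Propositional using (_∈_; find; lose)
open import Data.List.Membership.Propositional.Properties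
  using (∈-map⁺; ∈-map⁻; ∈-lookup; ∈-++⁺ˡ; ∈-allFin;
         ∈-cartesianProductWith⁺; ∈-cartesianProduct⁺; ∈-cartesianProduct⁻)
open import Data.List.Relation.Binary.Permutation.Propositional
  using (_↭_; ↭-refl; ↭-sym; ↭-trans; ↭-reflexive; ↭⇒↭ₛ; module PermutationReasoning)
import Data.List.Relation.Binary.Permutation.Propositional.Properties as Permutationₚ
import Data.List.Relation.Binary.Permutation.Setoid.Properties as Permutationₛ
open import Data.List.Relation.Unary.All using ([]; _∷_)
import Data.List.Relation.Unary.All as All
open import Data.List.Relation.Unary.AllPairs using (AllPairs; []; _∷_)
import Data.List.Relation.Unary.AllPairs as AllPairs
open import Data.List.Relation.Unary.Any using (Any; here; there; any?; index)
import Data.List.Relation.Unary.Any as Any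
open import Data.List.Relation.Unary.Any.Properties using (lookup-index)
import Data.List.Relation.Unary.Enumerates.Setoid.Properties as Enumerates
open import Data.List.Relation.Unary.Unique.DecSetoid.Properties using (deduplicate-!)
open import Data.List.Relation.Unary.Unique.Propositional using (Unique)
open import Data.List.Relation.Unary.Unique.Propositional.Properties using (cartesianProduct⁺; allFin⁺)
open import Data.Nat using (ℕ; zero; suc; s≤s; _%_; _≤_)
open import Data.Nat.DivMod using (m<n⇒m%n≡m; n%n≡0)
open import Data.Product using (Σ; _,_; proj₁; proj₂; _×_; map₁; map₂; swap)
open import Data.Sum using (_⊎_; inj₁; inj₂)
open import Data.Unit using (⊤; tt)
open import Data.Vec using (Vec; []; _∷_)
import Data.Vec as Vec
import Data.Vec.Properties as Vecₚ
open import Function using (id; _∘_; const)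
open import Function.Bundles using (Inverse)
open import Function.Properties.Inverse using (Inverse⇒Injection)
open import Relation.Binary.Bundles using (Setoid; DecSetoid)
open import Relation.Binary.Definitions using (DecidableEquality)
open import Relation.Binary.PropositionalEquality hiding ([_])
import Relation.Binary.Reasoning.Setoid as SetoidReasoning
open import Relation.Binary.Structures using (IsEquivalence)
open import Relation.Nullary.Decidable using (map′; ¬?; via-injection)
open import Relation.Nullary.Negation using (¬_)
open import Relation.Unary using (Decidable)
open import Defs

lookup-injective : ∀ {A B : Set} (f : A → B) xs → Unique (map f xs) →
                   ∀ {i j} → f (lookup xs i) ≡ f (lookup xs j) → i ≡ j
lookup-injective f (_ ∷ _)  _           {zero}  {zero}  _  = refl
lookup-injective f (_ ∷ _)  (fx∉ ∷ _) {zero}  {suc j} eq = ⊥-elim (All.lookup fx∉ (∈-map⁺ f (∈-lookup j)) eq)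
lookup-injective f (_ ∷ _)  (fx∉ ∷ _) {suc i} {zero}  eq = ⊥-elim (All.lookup fx∉ (∈-map⁺ f (∈-lookup i)) (sym eq))
lookup-injective f (_ ∷ xs) (_ ∷ u)    {suc i} {suc j} eq = cong suc (lookup-injective f xs u eq)

++-interchange-↭ : ∀ {A : Set} (xs ys zs ws : List A) → xs ++ (ys ++ (zs ++ ws)) ↭ (xs ++ zs) ++ (ys ++ ws)
++-interchange-↭ xs ys zs ws = begin
  xs ++ (ys ++ (zs ++ ws))   ≡⟨ cong (xs ++_) (Listₚ.++-assoc ys zs ws) ⟨
  xs ++ ((ys ++ zs) ++ ws)   ↭⟨ Permutationₚ.++⁺ˡ xs (Permutationₚ.++⁺ʳ ws (Permutationₚ.++-comm ys zs)) ⟩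
  xs ++ ((zs ++ ys) ++ ws)   ≡⟨ cong (xs ++_) (Listₚ.++-assoc zs ys ws) ⟩
  xs ++ (zs ++ (ys ++ ws))   ≡⟨ Listₚ.++-assoc xs zs (ys ++ ws) ⟨
  (xs ++ zs) ++ (ys ++ ws)   ∎
  where open PermutationReasoning

data Even {A : Set} : List A → Set where
  []   : Even []
  pair : ∀ {x y xs} → Even xs → Even (x ∷ y ∷ xs)

data Parity {A : Set} : List A → Set where
  even : ∀ {xs} → Even xs → Parity xs
  odd  : ∀ {x xs} → Even xs → Parity (x ∷ xs)

parity : ∀ {A : Set} (xs : List A) → Parity xs
parity []       = even []
parity (x ∷ xs) with parity xs
... | even e = odd e
... | odd e  = even (pair e)

module Geometry {q : ℕ} (𝔽 : FiniteField q) (n : ℕ) where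

  open FiniteField 𝔽

  private
    ring : CommutativeRing _ _
    ring = record { isCommutativeRing = isCommutativeRing }

  open CommutativeRing ring
    using (+-assoc; +-comm; +-identityˡ; +-identityʳ; -‿inverseˡ; -‿inverseʳ; distribʳ; zeroˡ; *-identityˡ)
  open RingProperties (CommutativeRing.ring ring)
    using (-1*x≈-x; -‿distribˡ-*; -‿distribʳ-*; -‿involutive) renaming (//-rightDividesˡ to +-//-rightDividesˡ)

  Point : Set
  Point = Pt 𝔽 n

  infixl 6 _+ᵥ_ _-ᵥ_
  infixr 7 _·ᵥ_

  _+ᵥ_ _-ᵥ_ : Point → Point → Point
  _+ᵥ_ = _+v_ 𝔽 n
  _-ᵥ_ = _-v_ 𝔽 n

  neg : Point → Point
  neg = Vec.map -_

  _·ᵥ_ : Carrier → Point → Point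
  _·ᵥ_ = _·v_ 𝔽 n

  0ᵥ : Point
  0ᵥ = 0v 𝔽 n

  -- x -ᵥ y unfolds to x +ᵥ neg y, i.e. to x // y in this group, so the group's division lemmas apply verbatim.
  +ᵥ-isAbelianGroup : IsAbelianGroup _≡_ _+ᵥ_ 0ᵥ neg
  +ᵥ-isAbelianGroup = record
    { isGroup = record
      { isMonoid = record
        { isSemigroup = record
          { isMagma = record { isEquivalence = isEquivalence ; ∙-cong = cong₂ _+ᵥ_ }
          ; assoc   = Vecₚ.zipWith-assoc +-assoc
          }
        ; identity = Vecₚ.zipWith-identityˡ +-identityˡ , Vecₚ.zipWith-identityʳ +-identityʳ
        }
      ; inverse = Vecₚ.zipWith-inverseˡ -‿inverseˡ , Vecₚ.zipWith-inverseʳ -‿inverseʳ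
      ; ⁻¹-cong = cong neg
      }
    ; comm = Vecₚ.zipWith-comm +-comm
    }

  pointGroup : AbelianGroup _ _
  pointGroup = record { isAbelianGroup = +ᵥ-isAbelianGroup }

  open AbelianGroup pointGroup public
    using () renaming (assoc to +ᵥ-assoc; comm to +ᵥ-comm; identityʳ to +ᵥ-identityʳ; inverseʳ to -ᵥ-inverseʳ)
  open AbelianGroupProperties pointGroup
    using (⁻¹-anti-homo‿-; ⁻¹-∙-comm; ⁻¹-involutive; x∙y⁻¹≈ε⇒x≈y; ∙-cancelʳ;
           //-rightDividesˡ; //-rightDividesʳ; \\-leftDividesʳ)
  open CommutativeSemigroupProperties (AbelianGroup.commutativeSemigroup pointGroup) using (interchange; xy∙z≈xz∙y)

  x-y+y≡x : ∀ x y → x -ᵥ y +ᵥ y ≡ x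
  x-y+y≡x x y = //-rightDividesˡ y x

  x+y-y≡x : ∀ x y → x +ᵥ y -ᵥ y ≡ x
  x+y-y≡x x y = //-rightDividesʳ y x

  x+[y-x]≡y : ∀ x y → x +ᵥ (y -ᵥ x) ≡ y
  x+[y-x]≡y x y = trans (+ᵥ-comm x (y -ᵥ x)) (x-y+y≡x y x)

  [x-y]+[y-z]≡x-z : ∀ x y z → (x -ᵥ y) +ᵥ (y -ᵥ z) ≡ x -ᵥ z
  [x-y]+[y-z]≡x-z x y z = trans (+ᵥ-assoc x (neg y) (y -ᵥ z)) (cong (x +ᵥ_) (\\-leftDividesʳ y (neg z)))

  [x+z]-[y+z]≡x-y : ∀ x y z → (x +ᵥ z) -ᵥ (y +ᵥ z) ≡ x -ᵥ y
  [x+z]-[y+z]≡x-y x y z = begin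
    (x +ᵥ z) +ᵥ neg (y +ᵥ z)       ≡⟨ cong (x +ᵥ z +ᵥ_) (⁻¹-∙-comm y z) ⟨
    (x +ᵥ z) +ᵥ (neg y +ᵥ neg z)   ≡⟨ interchange x z (neg y) (neg z) ⟩
    (x -ᵥ y) +ᵥ (z -ᵥ z)           ≡⟨ cong (x -ᵥ y +ᵥ_) (-ᵥ-inverseʳ z) ⟩
    (x -ᵥ y) +ᵥ 0ᵥ                 ≡⟨ +ᵥ-identityʳ (x -ᵥ y) ⟩
    x -ᵥ y                         ∎
    where open ≡-Reasoning

  [x+y-z]-x≡y-z : ∀ x y z → (x +ᵥ y -ᵥ z) -ᵥ x ≡ y -ᵥ z
  [x+y-z]-x≡y-z x y z = begin
    (x +ᵥ y -ᵥ z) -ᵥ x     ≡⟨ cong (_-ᵥ x) (+ᵥ-assoc x y (neg z)) ⟩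
    (x +ᵥ (y -ᵥ z)) -ᵥ x   ≡⟨ cong (_-ᵥ x) (+ᵥ-comm x (y -ᵥ z)) ⟩
    (y -ᵥ z) +ᵥ x -ᵥ x     ≡⟨ x+y-y≡x (y -ᵥ z) x ⟩
    y -ᵥ z                 ∎
    where open ≡-Reasoning

  neg[x-y]≡y-x : ∀ x y → neg (x -ᵥ y) ≡ y -ᵥ x
  neg[x-y]≡y-x = ⁻¹-anti-homo‿-

  x-y≡0⇒x≡y : ∀ {x y} → x -ᵥ y ≡ 0ᵥ → x ≡ y
  x-y≡0⇒x≡y {x} {y} = x∙y⁻¹≈ε⇒x≈y x y

  +ᵥ-cancelʳ : ∀ {x y} z → x +ᵥ z ≡ y +ᵥ z → x ≡ y
  +ᵥ-cancelʳ z = ∙-cancelʳ z _ _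

  ·ᵥ-distribʳ : ∀ a c v → (a + c) ·ᵥ v ≡ a ·ᵥ v +ᵥ c ·ᵥ v
  ·ᵥ-distribʳ a c = go
    where
    go : ∀ {m} (v : Vec Carrier m) → Vec.map ((a + c) *_) v ≡ Vec.zipWith _+_ (Vec.map (a *_) v) (Vec.map (c *_) v)
    go []      = refl
    go (x ∷ v) = cong₂ _∷_ (distribʳ x a c) (go v)

  0·ᵥ : ∀ v → 0# ·ᵥ v ≡ 0ᵥ
  0·ᵥ v = trans (Vecₚ.map-cong zeroˡ v) (Vecₚ.map-const v 0#)

  1·ᵥ : ∀ v → 1# ·ᵥ v ≡ v
  1·ᵥ v = trans (Vecₚ.map-cong *-identityˡ v) (Vecₚ.map-id v)

  -1·ᵥ : ∀ v → (- 1#) ·ᵥ v ≡ neg v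
  -1·ᵥ = Vecₚ.map-cong -1*x≈-x

  ·ᵥ-neg : ∀ c v → c ·ᵥ v ≡ (- c) ·ᵥ neg v
  ·ᵥ-neg c v = trans (Vecₚ.map-cong c*x≡-c*-x v) (Vecₚ.map-∘ ((- c) *_) -_ v)
    where
    c*x≡-c*-x : ∀ x → c * x ≡ (- c) * (- x)
    c*x≡-c*-x x = begin
      c * x           ≡⟨ -‿involutive (c * x) ⟨
      - (- (c * x))   ≡⟨ cong -_ (-‿distribˡ-* c x) ⟩
      - ((- c) * x)   ≡⟨ -‿distribʳ-* (- c) x ⟩
      (- c) * (- x)   ∎
      where open ≡-Reasoning

  x+av+cv≡x+[a+c]v : ∀ x a c v → x +ᵥ a ·ᵥ v +ᵥ c ·ᵥ v ≡ x +ᵥ (a + c) ·ᵥ v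
  x+av+cv≡x+[a+c]v x a c v = trans (+ᵥ-assoc x (a ·ᵥ v) (c ·ᵥ v)) (cong (x +ᵥ_) (sym (·ᵥ-distribʳ a c v)))

  Ln : Set
  Ln = Line 𝔽 n

  Direction : Set
  Direction = Dir 𝔽 n

  open Line public using (base; dir)

  infix 4 _∈ᴸ_ _≐ᴸ_

  _∈ᴸ_ : Point → Ln → Set
  _∈ᴸ_ = _∈L_ 𝔽 n

  _≐ᴸ_ : Ln → Ln → Set
  _≐ᴸ_ = _≐_ 𝔽 n

  ≐-isEquivalence : IsEquivalence _≐ᴸ_
  ≐-isEquivalence = record
    { refl  = λ z → id , id
    ; sym   = λ L≐L′ z → swap (L≐L′ z)
    ; trans = λ L≐L′ L′≐L″ z → proj₁ (L′≐L″ z) ∘ proj₁ (L≐L′ z) , proj₂ (L≐L′ z) ∘ proj₂ (L′≐L″ z)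
    }

  ≐-setoid : Setoid _ _
  ≐-setoid = record { isEquivalence = ≐-isEquivalence }

  open IsEquivalence ≐-isEquivalence public using () renaming (refl to ≐-refl)

  base-∈ : ∀ L → base L ∈ᴸ L
  base-∈ L = 0# , sym (trans (cong (base L +ᵥ_) (0·ᵥ _)) (+ᵥ-identityʳ (base L)))

  line-rebase : ∀ {x z} d → z ∈ᴸ mkLine x d → mkLine x d ≐ᴸ mkLine z d
  line-rebase {x} (v , _) (a , refl) w =
      (λ (c , w≡x+cv) → c + (- a) , trans w≡x+cv (x+cv≡z+[c-a]v c))
    , (λ (c , w≡z+cv) → a + c , trans w≡z+cv (x+av+cv≡x+[a+c]v x a c v))
    where
    a+[c-a]≡c : ∀ c → a + (c + (- a)) ≡ c
    a+[c-a]≡c c = trans (+-comm a (c + (- a))) (+-//-rightDividesˡ a c)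
    x+cv≡z+[c-a]v : ∀ c → x +ᵥ c ·ᵥ v ≡ x +ᵥ a ·ᵥ v +ᵥ (c + (- a)) ·ᵥ v
    x+cv≡z+[c-a]v c = begin
      x +ᵥ c ·ᵥ v                        ≡⟨ cong (λ e → x +ᵥ e ·ᵥ v) (a+[c-a]≡c c) ⟨
      x +ᵥ (a + (c + (- a))) ·ᵥ v        ≡⟨ x+av+cv≡x+[a+c]v x a (c + (- a)) v ⟨
      x +ᵥ a ·ᵥ v +ᵥ (c + (- a)) ·ᵥ v    ∎
      where open ≡-Reasoning

  line-negate : ∀ {x} d d′ → proj₁ d′ ≡ neg (proj₁ d) → mkLine x d ≐ᴸ mkLine x d′
  line-negate {x} (v , _) _ refl z =
      (λ (c , z≡x+cv) → - c , trans z≡x+cv (cong (x +ᵥ_) (·ᵥ-neg c v)))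
    , (λ (c , z≡x-cv) → - c , trans z≡x-cv (cong (x +ᵥ_) (c·neg≡-c· c)))
    where
    c·neg≡-c· : ∀ c → c ·ᵥ neg v ≡ (- c) ·ᵥ v
    c·neg≡-c· c = trans (·ᵥ-neg c (neg v)) (cong ((- c) ·ᵥ_) (⁻¹-involutive v))

  mkLine-cong : ∀ {x} d d′ → proj₁ d ≡ proj₁ d′ → mkLine x d ≐ᴸ mkLine x d′
  mkLine-cong _ _ refl z = id , id

  translate : Point → Ln → Ln
  translate t L = mkLine (base L +ᵥ t) (dir L)

  ∈-translate⁺ : ∀ t L {z} → z ∈ᴸ L → z +ᵥ t ∈ᴸ translate t L
  ∈-translate⁺ t L (c , refl) = c , xy∙z≈xz∙y (base L) (c ·ᵥ proj₁ (dir L)) t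

  ∈-translate⁻ : ∀ t L {z} → z ∈ᴸ translate t L → z -ᵥ t ∈ᴸ L
  ∈-translate⁻ t L (c , refl) = c , (begin
    base L +ᵥ t +ᵥ c ·ᵥ v -ᵥ t   ≡⟨ cong (_-ᵥ t) (xy∙z≈xz∙y (base L) t (c ·ᵥ v)) ⟩
    base L +ᵥ c ·ᵥ v +ᵥ t -ᵥ t   ≡⟨ x+y-y≡x (base L +ᵥ c ·ᵥ v) t ⟩
    base L +ᵥ c ·ᵥ v             ∎)
    where
    open ≡-Reasoning
    v = proj₁ (dir L)

  translate-cong : ∀ t L L′ → L ≐ᴸ L′ → translate t L ≐ᴸ translate t L′
  translate-cong t L L′ L≐L′ z = move L L′ (proj₁ ∘ L≐L′) , move L′ L (proj₂ ∘ L≐L′)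
    where
    move : ∀ L L′ → (∀ w → w ∈ᴸ L → w ∈ᴸ L′) → z ∈ᴸ translate t L → z ∈ᴸ translate t L′
    move L L′ L⊆L′ z∈ = subst (_∈ᴸ translate t L′) (x-y+y≡x z t) (∈-translate⁺ t L′ (L⊆L′ _ (∈-translate⁻ t L z∈)))

  translate-injective : ∀ t L L′ → translate t L ≐ᴸ translate t L′ → L ≐ᴸ L′
  translate-injective t L L′ tL≐tL′ z = move L L′ (proj₁ ∘ tL≐tL′) , move L′ L (proj₂ ∘ tL≐tL′)
    where
    move : ∀ L L′ → (∀ w → w ∈ᴸ translate t L → w ∈ᴸ translate t L′) → z ∈ᴸ L → z ∈ᴸ L′
    move L L′ tL⊆tL′ z∈ = subst (_∈ᴸ L′) (x+y-y≡x z t) (∈-translate⁻ t L′ (tL⊆tL′ _ (∈-translate⁺ t L z∈)))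

  PG : Set
  PG = PGPoint 𝔽 n

  Rep : PG → PG → Ln → Set
  Rep = Represents 𝔽 n

  shiftPG : Point → PG → PG
  shiftPG t (aff x) = aff (x +ᵥ t)
  shiftPG t (inf d) = inf d

  shiftPG-neg : ∀ x → shiftPG (neg x) (aff x) ≡ aff 0ᵥ
  shiftPG-neg x = cong aff (-ᵥ-inverseʳ x)

  -- The condition carried by the constructor aa of Represents (aff x) (aff y) L is, by definition, L ≐ᴸ join x≢y.
  join : ∀ {x y} → x ≢ y → Ln
  join {x} {y} x≢y = mkLine x (y -ᵥ x , x≢y ∘ sym ∘ x-y≡0⇒x≡y)

  ∈-join : ∀ {x y} (x≢y : x ≢ y) → y ∈ᴸ join x≢y
  ∈-join {x} {y} _ = 1# , sym (trans (cong (x +ᵥ_) (1·ᵥ (y -ᵥ x))) (x+[y-x]≡y x y))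

  join-comm : ∀ {x y} (x≢y : x ≢ y) → join x≢y ≐ᴸ join (x≢y ∘ sym)
  join-comm {x} {y} x≢y = begin
    join x≢y                    ≈⟨ line-rebase (dir (join x≢y)) (∈-join x≢y) ⟩
    mkLine y (dir (join x≢y))   ≈⟨ line-negate (dir (join x≢y)) (dir (join (x≢y ∘ sym))) (sym (neg[x-y]≡y-x y x)) ⟩
    join (x≢y ∘ sym)            ∎
    where open SetoidReasoning ≐-setoid

  represents-sym : ∀ {a b L} → Rep a b L → Rep b a L
  represents-sym {L = L} (aa x≢y L≐) = aa (x≢y ∘ sym) (begin
    L                  ≈⟨ L≐ ⟩
    join x≢y           ≈⟨ join-comm x≢y ⟩
    join (x≢y ∘ sym)   ∎)
    where open SetoidReasoning ≐-setoid
  represents-sym (ai L≐) = ia L≐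
  represents-sym (ia L≐) = ai L≐

  represents-shift : ∀ t {a b L} → Rep a b L → Rep (shiftPG t a) (shiftPG t b) (translate t L)
  represents-shift t {L = L} (aa {x} {y} x≢y L≐) = aa x+t≢y+t (begin
    translate t L            ≈⟨ translate-cong t L (join x≢y) L≐ ⟩
    translate t (join x≢y)   ≈⟨ mkLine-cong (dir (join x≢y)) (dir (join x+t≢y+t)) (sym ([x+z]-[y+z]≡x-y y x t)) ⟩
    join x+t≢y+t             ∎)
    where
    open SetoidReasoning ≐-setoid
    x+t≢y+t : x +ᵥ t ≢ y +ᵥ t
    x+t≢y+t = x≢y ∘ +ᵥ-cancelʳ t
  represents-shift t {L = L} (ai {x} {d} L≐) = ai (translate-cong t L (mkLine x d) L≐)
  represents-shift t {L = L} (ia {x} {d} L≐) = ia (translate-cong t L (mkLine x d) L≐)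

  represents-irrefl : ∀ {x L} → ¬ Rep (aff x) (aff x) L
  represents-irrefl (aa x≢x _) = x≢x refl

  represents-unique : ∀ {x y L L′} → Rep (aff x) (aff y) L → Rep (aff x) (aff y) L′ → L ≐ᴸ L′
  represents-unique {L = L} {L′} (aa x≢y L≐) (aa _ L′≐) = begin
    L          ≈⟨ L≐ ⟩
    join x≢y   ≈⟨ L′≐ ⟨
    L′         ∎
    where open SetoidReasoning ≐-setoid

  represents-∈ˡ : ∀ {x b L} → Rep (aff x) b L → x ∈ᴸ L
  represents-∈ˡ (aa x≢y L≐)     = proj₂ (L≐ _) (base-∈ (join x≢y))
  represents-∈ˡ (ai {x} {d} L≐) = proj₂ (L≐ x) (base-∈ (mkLine x d))

  represents-∈ʳ : ∀ {a y L} → Rep a (aff y) L → y ∈ᴸ L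
  represents-∈ʳ = represents-∈ˡ ∘ represents-sym

  atInfinity : Ln → PG
  atInfinity L = inf (dir L)

  represents-atInfinityˡ : ∀ {a y L} → Rep a (aff y) L → Rep (atInfinity L) (aff y) L
  represents-atInfinityˡ {L = L} r = ia (line-rebase (dir L) (represents-∈ʳ r))

  represents-atInfinityʳ : ∀ {x b L} → Rep (aff x) b L → Rep (aff x) (atInfinity L) L
  represents-atInfinityʳ {L = L} r = ai (line-rebase (dir L) (represents-∈ˡ r))

module Finite {q : ℕ} (𝔽 : FiniteField q) where

  open FiniteField 𝔽
  open Inverse card using (to; from; strictlyInverseʳ)

  _≟_ : DecidableEquality Carrier
  _≟_ = via-injection (Inverse⇒Injection card) Finₚ._≟_

  elements : List Carrier
  elements = map from (allFin q)

  ∈-elements : ∀ x → x ∈ elements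
  ∈-elements x = subst (_∈ elements) (strictlyInverseʳ x) (∈-map⁺ from (∈-allFin (to x)))

  vectors : ∀ m → List (Vec Carrier m)
  vectors zero    = [ [] ]
  vectors (suc m) = cartesianProductWith _∷_ elements (vectors m)

  ∈-vectors : ∀ {m} (v : Vec Carrier m) → v ∈ vectors m
  ∈-vectors []      = here refl
  ∈-vectors (x ∷ v) = ∈-cartesianProductWith⁺ _∷_ (∈-elements x) (∈-vectors v)

  span-decidable : ∀ {n U k} → HasDim 𝔽 n U k → Decidable U
  span-decidable {n} {U} {k} (basis , _ , spans) x =
    map′ (λ c∈ → let (c , _ , e) = find c∈ in proj₂ (spans x) (c , e))
         (λ u → let (c , e) = proj₁ (spans x) u in lose (∈-vectors c) e)
         (any? (λ c → Vecₚ.≡-dec _≟_ (lincomb 𝔽 n c basis) x) (vectors k))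

module Cosets {q : ℕ} (𝔽 : FiniteField q) (n : ℕ) (U : Pt 𝔽 n → Set)
              (U-subspace : IsSubspace 𝔽 n U) (U? : Decidable U) where

  open FiniteField 𝔽 using (-_; 1#)
  open Geometry 𝔽 n
  open Finite 𝔽 using (vectors; ∈-vectors)
  open IsSubspace U-subspace

  -ᵥ-closed : ∀ {x y} → U x → U y → U (x -ᵥ y)
  -ᵥ-closed {x} {y} Ux Uy = subst U (cong (x +ᵥ_) (-1·ᵥ y)) (+-closed x _ Ux (·-closed (- 1#) y Uy))

  infix 4 _∼_

  _∼_ : Point → Point → Set
  x ∼ y = U (x -ᵥ y)

  ∼-refl : ∀ {x} → x ∼ x
  ∼-refl {x} = subst U (sym (-ᵥ-inverseʳ x)) zero∈

  ∼-sym : ∀ {x y} → x ∼ y → y ∼ x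
  ∼-sym {x} {y} x∼y = subst U (trans (-1·ᵥ (x -ᵥ y)) (neg[x-y]≡y-x x y)) (·-closed (- 1#) _ x∼y)

  ∼-trans : ∀ {x y z} → x ∼ y → y ∼ z → x ∼ z
  ∼-trans {x} {y} {z} x∼y y∼z = subst U ([x-y]+[y-z]≡x-z x y z) (+-closed _ _ x∼y y∼z)

  cosetDecSetoid : DecSetoid _ _
  cosetDecSetoid = record
    { _≈_ = _∼_
    ; isDecEquivalence = record
      { isEquivalence = record { refl = ∼-refl ; sym = ∼-sym ; trans = ∼-trans }
      ; _≟_           = λ x y → U? (x -ᵥ y)
      }
    }

  open DecSetoid cosetDecSetoid using (_≟_)

  otherRepresentatives : Point → List Point
  otherRepresentatives t₀ = filter (¬? ∘ (t₀ ≟_)) (deduplicate _≟_ (vectors n))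

  representatives : Point → List Point
  representatives t₀ = t₀ ∷ otherRepresentatives t₀

  representatives-complete : ∀ t₀ x → Any (x ∼_) (representatives t₀)
  representatives-complete t₀ = Enumerates.deduplicate⁺ cosetDecSetoid
    (λ x → there (Any.map (λ { refl → ∼-refl }) (∈-vectors x)))

  representatives-inequivalent : ∀ t₀ → AllPairs (λ s t → ¬ s ∼ t) (representatives t₀)
  representatives-inequivalent t₀ = deduplicate-! cosetDecSetoid (t₀ ∷ vectors n)

  representatives-unique : ∀ t₀ → Unique (representatives t₀)
  representatives-unique t₀ =
    AllPairs.map (λ s≁t s≡t → s≁t (subst (_ ∼_) s≡t ∼-refl)) (representatives-inequivalent t₀)

  representatives-∼⇒≡ : ∀ t₀ {s t} → s ∈ representatives t₀ → t ∈ representatives t₀ → s ∼ t → s ≡ t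
  representatives-∼⇒≡ t₀ = go (representatives-inequivalent t₀)
    where
    go : ∀ {ts s t} → AllPairs (λ s t → ¬ s ∼ t) ts → s ∈ ts → t ∈ ts → s ∼ t → s ≡ t
    go _          (here refl) (here refl) _   = refl
    go (s≁ ∷ _)   (here refl) (there t∈)  s∼t = ⊥-elim (All.lookup s≁ t∈ s∼t)
    go (t≁ ∷ _)   (there s∈)  (here refl) s∼t = ⊥-elim (All.lookup t≁ s∈ (∼-sym s∼t))
    go (_ ∷ ts≁) (there s∈)  (there t∈)  s∼t = go ts≁ s∈ t∈ s∼t

module CyclicSuccessor {q : ℕ} (𝔽 : FiniteField q) (n : ℕ) where

  next-inject₁ : ∀ {m} (j : Fin m) → next 𝔽 n (inject₁ j) ≡ suc j
  next-inject₁ {m} j = Finₚ.toℕ-injective (begin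
    toℕ (next 𝔽 n (inject₁ j))      ≡⟨ Finₚ.toℕ-fromℕ< _ ⟩
    suc (toℕ (inject₁ j)) % suc m   ≡⟨ cong (λ k → suc k % suc m) (Finₚ.toℕ-inject₁ j) ⟩
    suc (toℕ j) % suc m             ≡⟨ m<n⇒m%n≡m (s≤s (Finₚ.toℕ<n j)) ⟩
    suc (toℕ j)                     ∎)
    where open ≡-Reasoning

  next-fromℕ : ∀ m → next 𝔽 n (fromℕ m) ≡ zero
  next-fromℕ m = Finₚ.toℕ-injective (begin
    toℕ (next 𝔽 n (fromℕ m))      ≡⟨ Finₚ.toℕ-fromℕ< _ ⟩
    suc (toℕ (fromℕ m)) % suc m   ≡⟨ cong (λ k → suc k % suc m) (Finₚ.toℕ-fromℕ m) ⟩
    suc m % suc m                 ≡⟨ n%n≡0 (suc m) ⟩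
    0                             ∎)
    where open ≡-Reasoning

  data LastOrInject : ∀ {m} → Fin (suc m) → Set where
    last   : ∀ {m} → LastOrInject (fromℕ m)
    inject : ∀ {m} (j : Fin m) → LastOrInject (inject₁ j)

  lastOrInject : ∀ {m} (i : Fin (suc m)) → LastOrInject i
  lastOrInject {zero}  zero    = last
  lastOrInject {suc m} zero    = inject zero
  lastOrInject {suc m} (suc i) with lastOrInject i
  ... | last     = last
  ... | inject j = inject (suc j)

module Walks {q : ℕ} (𝔽 : FiniteField q) (n : ℕ) {Label : Set} (lineOf : Label → Line 𝔽 n) where

  open Geometry 𝔽 n
  open CyclicSuccessor 𝔽 n

  Step : Set
  Step = PG × Label

  point : Step → PG
  point = proj₁

  label : Step → Label
  label = proj₂

  start : List Step → PG → PG
  start []      s = s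
  start (e ∷ _) _ = point e

  Window : Step → PG → Set
  Window e b = Rep (point e) b (lineOf (label e))

  infixr 5 _∷_

  data Walk : List Step → PG → Set where
    []  : ∀ {s} → Walk [] s
    _∷_ : ∀ {e es s} → Window e (start es s) → Walk es s → Walk (e ∷ es) s

  start-++ : ∀ xs ys s → start (xs ++ ys) s ≡ start xs (start ys s)
  start-++ []      _ _ = refl
  start-++ (_ ∷ _) _ _ = refl

  walk-++ : ∀ {xs ys s} → Walk xs (start ys s) → Walk ys s → Walk (xs ++ ys) s
  walk-++                   []      w = w
  walk-++ {x ∷ xs} {ys} {s} (r ∷ v) w = subst (Window x) (sym (start-++ xs ys s)) r ∷ walk-++ v w

  walk-++⁻ : ∀ xs {ys s} → Walk (xs ++ ys) s → Walk xs (start ys s) × Walk ys s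
  walk-++⁻ []                 w       = [] , w
  walk-++⁻ (x ∷ xs) {ys} {s} (r ∷ w) =
    subst (Window x) (start-++ xs ys s) r ∷ proj₁ (walk-++⁻ xs w) , proj₂ (walk-++⁻ xs w)

  ClosedWalk : List Step → Set
  ClosedWalk []       = ⊤
  ClosedWalk (e ∷ es) = Walk (e ∷ es) (point e)

  closedWalk-rotate : ∀ xs ys → ClosedWalk (xs ++ ys) → ClosedWalk (ys ++ xs)
  closedWalk-rotate []       ys       c = subst ClosedWalk (sym (Listₚ.++-identityʳ ys)) c
  closedWalk-rotate (x ∷ xs) []       c = subst ClosedWalk (Listₚ.++-identityʳ (x ∷ xs)) c
  closedWalk-rotate (x ∷ xs) (y ∷ ys) c = walk-++ (proj₂ (walk-++⁻ (x ∷ xs) c)) (proj₁ (walk-++⁻ (x ∷ xs) c))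

  walk⇒closedWalk : ∀ {xs a} → Walk xs a → start xs a ≡ a → ClosedWalk xs
  walk⇒closedWalk {[]}     _ _  = tt
  walk⇒closedWalk {e ∷ es} w eq = subst (Walk (e ∷ es)) (sym eq) w

  walk-tabulate : ∀ {m} (h : Fin (suc m) → Step) {s} →
    (∀ j → Window (h (inject₁ j)) (point (h (suc j)))) → Window (h (fromℕ m)) s → Walk (tabulate h) s
  walk-tabulate {zero}  h steps final = final ∷ []
  walk-tabulate {suc m} h steps final = steps zero ∷ walk-tabulate (h ∘ suc) (steps ∘ suc) final

  closedWalk-tabulate : ∀ {N} (h : Fin N → Step) →
    (∀ i → Window (h i) (point (h (next 𝔽 n i)))) → ClosedWalk (tabulate h)
  closedWalk-tabulate {zero}  h window = tt
  closedWalk-tabulate {suc m} h window = walk-tabulate h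
    (λ j → subst (Window (h (inject₁ j)) ∘ point ∘ h) (next-inject₁ j) (window (inject₁ j)))
    (subst (Window (h (fromℕ m)) ∘ point ∘ h) (next-fromℕ m) (window (fromℕ m)))

  walk-lookup-inject₁ : ∀ {e es s} → Walk (e ∷ es) s → ∀ j →
    Window (lookup (e ∷ es) (inject₁ j)) (point (lookup (e ∷ es) (suc j)))
  walk-lookup-inject₁ {es = _ ∷ _} (r ∷ _) zero    = r
  walk-lookup-inject₁ {es = _ ∷ _} (_ ∷ w) (suc j) = walk-lookup-inject₁ w j

  walk-lookup-fromℕ : ∀ {e es s} → Walk (e ∷ es) s → Window (lookup (e ∷ es) (fromℕ (length es))) s
  walk-lookup-fromℕ {es = []}    (r ∷ []) = r
  walk-lookup-fromℕ {es = _ ∷ _} (_ ∷ w)  = walk-lookup-fromℕ w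

  closedWalk-lookup : ∀ xs → ClosedWalk xs → ∀ i → Window (lookup xs i) (point (lookup xs (next 𝔽 n i)))
  closedWalk-lookup xs@(_ ∷ es) w i with lastOrInject i
  ... | last     = subst (Window (lookup xs i) ∘ point ∘ lookup xs) (sym (next-fromℕ (length es)))
                         (walk-lookup-fromℕ w)
  ... | inject j = subst (Window (lookup xs i) ∘ point ∘ lookup xs) (sym (next-inject₁ j))
                         (walk-lookup-inject₁ w j)

  record Arc (a b : PG) (ls : List Label) : Set where
    field
      steps  : List Step
      walk   : Walk steps b
      starts : start steps b ≡ a
      labels : map label steps ↭ ls

  open Arc public

  emptyArc : ∀ {a} → Arc a a []
  emptyArc = record { steps = [] ; walk = [] ; starts = refl ; labels = ↭-refl }

  infixr 5 _⨾_

  _⨾_ : ∀ {a b c ls ls′} → Arc a b ls → Arc b c ls′ → Arc a c (ls ++ ls′)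
  _⨾_ {c = c} A B = record
    { steps  = steps A ++ steps B
    ; walk   = walk-++ (subst (Walk (steps A)) (sym (starts B)) (walk A)) (walk B)
    ; starts = trans (start-++ (steps A) (steps B) c) (trans (cong (start (steps A)) (starts B)) (starts A))
    ; labels = ↭-trans (↭-reflexive (Listₚ.map-++ label (steps A) (steps B))) (Permutationₚ.++⁺ (labels A) (labels B))
    }

  ∈-points-⨾ˡ : ∀ {a b c ls ls′ x} (A : Arc a b ls) (B : Arc b c ls′) →
                x ∈ map point (steps A) → x ∈ map point (steps (A ⨾ B))
  ∈-points-⨾ˡ A B x∈ = subst (_ ∈_) (sym (Listₚ.map-++ point (steps A) (steps B))) (∈-++⁺ˡ x∈)

  arc-relabel : ∀ {a b ls ls′} → ls ↭ ls′ → Arc a b ls → Arc a b ls′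
  arc-relabel ls↭ls′ A = record
    { steps = steps A ; walk = walk A ; starts = starts A ; labels = ↭-trans (labels A) ls↭ls′ }

  arc-closed : ∀ {a ls} (A : Arc a a ls) → ClosedWalk (steps A)
  arc-closed A = walk⇒closedWalk (walk A) (starts A)

  closedWalk⇒arc : ∀ e es → ClosedWalk (e ∷ es) → Arc (point e) (point e) (map label (e ∷ es))
  closedWalk⇒arc e es w = record { steps = e ∷ es ; walk = w ; starts = refl ; labels = ↭-refl }

  affine : List (Point × Label) → List Step
  affine = map (map₁ aff)

  labelsᴬ : List (Point × Label) → List Label
  labelsᴬ = map proj₂

  label-affine : ∀ V → map label (affine V) ≡ labelsᴬ V
  label-affine V = sym (Listₚ.map-∘ V)

  affine-++ : ∀ V W → affine (V ++ W) ≡ affine V ++ affine W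
  affine-++ = Listₚ.map-++ (map₁ aff)

  closedWalkᴬ-rotate : ∀ V W → ClosedWalk (affine (V ++ W)) → ClosedWalk (affine (W ++ V))
  closedWalkᴬ-rotate V W c = subst ClosedWalk (sym (affine-++ W V))
    (closedWalk-rotate (affine V) (affine W) (subst ClosedWalk (affine-++ V W) c))

  closedWalkᴬ⇒arc : ∀ x l V → ClosedWalk (affine ((x , l) ∷ V)) → Arc (aff x) (aff x) (labelsᴬ ((x , l) ∷ V))
  closedWalkᴬ⇒arc x l V w =
    arc-relabel (↭-reflexive (label-affine ((x , l) ∷ V))) (closedWalk⇒arc (aff x , l) (affine V) w)

  atInfinityOf : Label → PG
  atInfinityOf l = atInfinity (lineOf l)

  walk-endAtInfinity : ∀ M {x l z} → Walk (affine (M ∷ʳ (x , l))) (aff z) →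
                       Walk (affine (M ∷ʳ (x , l))) (atInfinityOf l)
  walk-endAtInfinity []          (r ∷ []) = represents-atInfinityʳ r ∷ []
  walk-endAtInfinity (_ ∷ [])    (r ∷ w)  = r ∷ walk-endAtInfinity [] w
  walk-endAtInfinity (_ ∷ m ∷ M) (r ∷ w)  = r ∷ walk-endAtInfinity (m ∷ M) w

  walk-open : ∀ {x₀ l₀} M {x₁ l₁ z} → Walk (affine ((x₀ , l₀) ∷ M ∷ʳ (x₁ , l₁))) (aff z) →
              Walk ((atInfinityOf l₀ , l₀) ∷ affine (M ∷ʳ (x₁ , l₁))) (atInfinityOf l₁)
  walk-open []      (r ∷ w) = represents-atInfinityˡ r ∷ walk-endAtInfinity [] w
  walk-open (_ ∷ M) (r ∷ w) = represents-atInfinityˡ r ∷ walk-endAtInfinity (_ ∷ M) w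

  openArc : ∀ {x₀ l₀} M {x₁ l₁ z} → Walk (affine ((x₀ , l₀) ∷ M ∷ʳ (x₁ , l₁))) (aff z) →
            Arc (atInfinityOf l₀) (atInfinityOf l₁) (labelsᴬ ((x₀ , l₀) ∷ M ∷ʳ (x₁ , l₁)))
  openArc {l₀ = l₀} M {x₁} {l₁} w = record
    { steps  = (atInfinityOf l₀ , l₀) ∷ affine (M ∷ʳ (x₁ , l₁))
    ; walk   = walk-open M w
    ; starts = refl
    ; labels = ↭-reflexive (cong (l₀ ∷_) (label-affine (M ∷ʳ (x₁ , l₁))))
    }

  startᴬ : List (Point × Label) → Point → Point
  startᴬ []            z = z
  startᴬ ((x , _) ∷ _) _ = x

  start-affine : ∀ V z → start (affine V) (aff z) ≡ aff (startᴬ V z)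
  start-affine []      _ = refl
  start-affine (_ ∷ _) _ = refl

  startᴬ-∷ʳ : ∀ M {x l z} → startᴬ (M ∷ʳ (x , l)) z ≡ startᴬ M x
  startᴬ-∷ʳ []      = refl
  startᴬ-∷ʳ (_ ∷ _) = refl

  -- reverseᴬ V z runs the walk V, which ends at z, backwards: it starts at z and every window keeps its label.
  reverseᴬ : List (Point × Label) → Point → List (Point × Label)
  reverseᴬ []            _ = []
  reverseᴬ ((_ , l) ∷ V) z = reverseᴬ V z ∷ʳ (startᴬ V z , l)

  reverseᴬ-∷ʳ : ∀ M x l z → reverseᴬ (M ∷ʳ (x , l)) z ≡ (z , l) ∷ reverseᴬ M x
  reverseᴬ-∷ʳ []             x l z = refl
  reverseᴬ-∷ʳ ((_ , l′) ∷ M) x l z = cong₂ _∷ʳ_ (reverseᴬ-∷ʳ M x l z) (cong (_, l′) (startᴬ-∷ʳ M))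

  labelsᴬ-reverseᴬ : ∀ V z → labelsᴬ (reverseᴬ V z) ≡ reverse (labelsᴬ V)
  labelsᴬ-reverseᴬ []            z = refl
  labelsᴬ-reverseᴬ ((_ , l) ∷ V) z = begin
    labelsᴬ (reverseᴬ V z ∷ʳ (startᴬ V z , l))   ≡⟨ Listₚ.map-++ proj₂ (reverseᴬ V z) _ ⟩
    labelsᴬ (reverseᴬ V z) ∷ʳ l                   ≡⟨ cong (_∷ʳ l) (labelsᴬ-reverseᴬ V z) ⟩
    reverse (labelsᴬ V) ∷ʳ l                      ≡⟨ Listₚ.unfold-reverse l (labelsᴬ V) ⟨
    reverse (l ∷ labelsᴬ V)                       ∎
    where open ≡-Reasoning

  walk-reverseᴬ : ∀ V {z} → Walk (affine V) (aff z) → Walk (affine (reverseᴬ V z)) (aff (startᴬ V z))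
  walk-reverseᴬ []                  []      = []
  walk-reverseᴬ ((x , l) ∷ V) {z} (r ∷ w) =
    subst (λ ys → Walk ys (aff x)) (sym (affine-++ (reverseᴬ V z) [ (startᴬ V z , l) ]))
      (walk-++ (walk-reverseᴬ V w) (represents-sym (subst (Window (aff x , l)) (start-affine V z) r) ∷ []))

  reverseArc : ∀ {x₀ l₀} M {x₁ l₁} → ClosedWalk (affine ((x₀ , l₀) ∷ M ∷ʳ (x₁ , l₁))) →
               Arc (atInfinityOf l₁) (atInfinityOf l₀) (labelsᴬ ((x₀ , l₀) ∷ M ∷ʳ (x₁ , l₁)))
  reverseArc {x₀} {l₀} M {x₁} {l₁} closed = arc-relabel relabel
    (openArc (reverseᴬ M x₁) (subst (λ V → Walk (affine V) (aff x₀)) reversed (walk-reverseᴬ V closed)))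
    where
    V = (x₀ , l₀) ∷ M ∷ʳ (x₁ , l₁)
    y = startᴬ (M ∷ʳ (x₁ , l₁)) x₀
    reversed : reverseᴬ V x₀ ≡ (x₀ , l₁) ∷ reverseᴬ M x₁ ∷ʳ (y , l₀)
    reversed = cong (_∷ʳ (y , l₀)) (reverseᴬ-∷ʳ M x₁ l₁ x₀)
    relabel : labelsᴬ ((x₀ , l₁) ∷ reverseᴬ M x₁ ∷ʳ (y , l₀)) ↭ labelsᴬ V
    relabel = ↭-trans (↭-reflexive (trans (cong labelsᴬ (sym reversed)) (labelsᴬ-reverseᴬ V x₀)))
                      (Permutationₚ.↭-reverse (labelsᴬ V))

  affineOrInfinite : ∀ xs → (Σ (List (Point × Label)) λ V → xs ≡ affine V)
                         ⊎ (Σ (List Step) λ P → Σ Direction λ d → Σ Label λ l → Σ (List Step) λ Q →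
                              xs ≡ P ++ (inf d , l) ∷ Q)
  affineOrInfinite []                = inj₁ ([] , refl)
  affineOrInfinite ((inf d , l) ∷ xs) = inj₂ ([] , d , l , xs , refl)
  affineOrInfinite ((aff x , l) ∷ xs) with affineOrInfinite xs
  ... | inj₁ (V , refl)              = inj₁ ((x , l) ∷ V , refl)
  ... | inj₂ (P , d , l′ , Q , refl) = inj₂ ((aff x , l) ∷ P , d , l′ , Q , refl)

  module _ (𝓕 : Ln → Set) (ls : List Label) (ls-unique : Unique ls)
           (lineOf-injective : ∀ {l l′} → l ∈ ls → l′ ∈ ls → lineOf l ≐ᴸ lineOf l′ → l ≡ l′)
           (lineOf-sound : ∀ {l} → l ∈ ls → 𝓕 (lineOf l))
           (lineOf-complete : ∀ L → 𝓕 L → Σ Label λ l → l ∈ ls × lineOf l ≐ᴸ L) where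

    universalCycle : ∀ xs → ClosedWalk xs → map label xs ↭ ls → UniversalCycle 𝔽 n 𝓕
    universalCycle xs closed xs↭ls = record
      { N        = length xs
      ; p        = point ∘ lookup xs
      ; line     = lineOf ∘ label ∘ lookup xs
      ; rep      = closedWalk-lookup xs closed
      ; distinct = λ i j ≐ → lookup-injective label xs labels-unique (lineOf-injective (∈ls i) (∈ls j) ≐)
      ; inFam    = lineOf-sound ∘ ∈ls
      ; covers   = covers
      }
      where
      ∈ls : ∀ i → label (lookup xs i) ∈ ls
      ∈ls i = Permutationₚ.∈-resp-↭ xs↭ls (∈-map⁺ label (∈-lookup i))
      labels-unique : Unique (map label xs)
      labels-unique = Permutationₛ.Unique-resp-↭ (setoid Label) (↭⇒↭ₛ (↭-sym xs↭ls)) ls-unique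
      covers : ∀ L → 𝓕 L → Σ (Fin (length xs)) λ i → lineOf (label (lookup xs i)) ≐ᴸ L
      covers L L∈𝓕 with lineOf-complete L L∈𝓕
      ... | l , l∈ls , l≐L with ∈-map⁻ label (Permutationₚ.∈-resp-↭ (↭-sym xs↭ls) l∈ls)
      ...   | e , e∈xs , refl = index e∈xs , subst (λ e → lineOf (label e) ≐ᴸ L) (lookup-index e∈xs) l≐L

    universalCycle-containsZero : ∀ xs closed xs↭ls → aff 0ᵥ ∈ map point xs →
                                  ContainsZero 𝔽 n (universalCycle xs closed xs↭ls)
    universalCycle-containsZero xs _ _ 0∈ with ∈-map⁻ point 0∈
    ... | e , e∈xs , 0≡e = index e∈xs , sym (trans 0≡e (cong point (lookup-index e∈xs)))

module Lifting {q : ℕ} (𝔽 : FiniteField q) (n : ℕ)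
               (U : Pt 𝔽 n → Set) (U-subspace : IsSubspace 𝔽 n U) (U? : Decidable U)
               (D : Dir 𝔽 n → Set) (D⊆U : ∀ d → D d → SpanIn 𝔽 n d U)
               (CU : UniversalCycle 𝔽 n (LinesIn 𝔽 n U D)) where

  open Geometry 𝔽 n
  open Cosets 𝔽 n U U-subspace U?
  open IsSubspace U-subspace
  open UniversalCycle CU
  module Base = Walks 𝔽 n line

  line⊆U : ∀ i {z} → z ∈ᴸ line i → U z
  line⊆U i z∈ with inFam i
  ... | x , (v , _) , Dv , Ux , line≐ with proj₁ (line≐ _) z∈
  ...   | c , refl = +-closed x (c ·ᵥ v) Ux (D⊆U _ Dv c)

  baseWalk : List Base.Step
  baseWalk = tabulate (λ i → p i , i)

  baseWalk-closed : Base.ClosedWalk baseWalk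
  baseWalk-closed = Base.closedWalk-tabulate _ rep

  baseWalk-labels : map Base.label baseWalk ↭ allFin N
  baseWalk-labels = ↭-reflexive (Listₚ.map-tabulate _ Base.label)

  N≡0⇒¬Fin : N ≡ 0 → ¬ Fin N
  N≡0⇒¬Fin N≡0 i with () ← subst Fin N≡0 i

  emptyCycle : N ≡ 0 → UniversalCycle 𝔽 n (AllLines 𝔽 n D)
  emptyCycle N≡0 = record
    { N = 0 ; p = λ () ; line = λ () ; rep = λ () ; distinct = λ () ; inFam = λ ()
    ; covers = λ { _ (_ , d , Dd , _) → ⊥-elim (N≡0⇒¬Fin N≡0 (proj₁ (covers (mkLine 0ᵥ d) (line-0+d Dd)))) }
    }
    where
    line-0+d : ∀ {d} → D d → LinesIn 𝔽 n U D (mkLine 0ᵥ d)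
    line-0+d {d} Dd = 0ᵥ , d , Dd , zero∈ , ≐-refl {mkLine 0ᵥ d}

  module Lift (t₀ : Point) where

    Label : Set
    Label = Point × Fin N

    lineOf : Label → Ln
    lineOf (t , i) = translate t (line i)

    module Lifted = Walks 𝔽 n lineOf

    labelsOf : Point → List Label
    labelsOf t = map (t ,_) (allFin N)

    allLabels : List Label
    allLabels = cartesianProduct (representatives t₀) (allFin N)

    allLabels-unique : Unique allLabels
    allLabels-unique = cartesianProduct⁺ (representatives-unique t₀) (allFin⁺ N)

    lineOf-injective : ∀ {l l′} → l ∈ allLabels → l′ ∈ allLabels → lineOf l ≐ᴸ lineOf l′ → l ≡ l′
    lineOf-injective {t , i} {t′ , i′} l∈ l′∈ tL≐t′L′ =
      cong₂ _,_ t≡t′ (distinct i i′ (translate-injective t′ (line i) (line i′) t′L≐t′L′))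
      where
      b = base (line i)
      b+t-t′∈line : b +ᵥ t -ᵥ t′ ∈ᴸ line i′
      b+t-t′∈line = ∈-translate⁻ t′ (line i′) (proj₁ (tL≐t′L′ _) (∈-translate⁺ t (line i) (base-∈ (line i))))
      t≡t′ : t ≡ t′
      t≡t′ = representatives-∼⇒≡ t₀ (proj₁ (∈-cartesianProduct⁻ _ _ l∈)) (proj₁ (∈-cartesianProduct⁻ _ _ l′∈))
        (subst U ([x+y-z]-x≡y-z b t t′) (-ᵥ-closed (line⊆U i′ b+t-t′∈line) (line⊆U i (base-∈ (line i)))))
      t′L≐t′L′ : translate t′ (line i) ≐ᴸ translate t′ (line i′)
      t′L≐t′L′ = subst (λ s → translate s (line i) ≐ᴸ translate t′ (line i′)) t≡t′ tL≐t′L′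

    lineOf-sound : ∀ {l} → l ∈ allLabels → AllLines 𝔽 n D (lineOf l)
    lineOf-sound {t , i} _ with inFam i
    ... | x , d , Dd , _ , line≐ = x +ᵥ t , d , Dd , translate-cong t (line i) (mkLine x d) line≐

    lineOf-complete : ∀ L → AllLines 𝔽 n D L → Σ Label λ l → l ∈ allLabels × lineOf l ≐ᴸ L
    lineOf-complete L (x , d , Dd , L≐) with find (representatives-complete t₀ x)
    ... | t , t∈ , x∼t with covers (mkLine (x -ᵥ t) d) (x -ᵥ t , d , Dd , x∼t , ≐-refl {mkLine (x -ᵥ t) d})
    ...   | i , line≐ = (t , i) , ∈-cartesianProduct⁺ t∈ (∈-allFin i) , (begin
      translate t (line i)             ≈⟨ translate-cong t (line i) (mkLine (x -ᵥ t) d) line≐ ⟩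
      mkLine (x -ᵥ t +ᵥ t) d           ≡⟨ cong (λ y → mkLine y d) (x-y+y≡x x t) ⟩
      mkLine x d                       ≈⟨ L≐ ⟨
      L                                ∎)
      where open SetoidReasoning ≐-setoid

    liftedCycle : ∀ {a} → Lifted.Arc a a allLabels → UniversalCycle 𝔽 n (AllLines 𝔽 n D)
    liftedCycle A = Lifted.universalCycle (AllLines 𝔽 n D) allLabels allLabels-unique
      lineOf-injective lineOf-sound lineOf-complete (Lifted.steps A) (Lifted.arc-closed A) (Lifted.labels A)

    liftedCycle-containsZero : ∀ {a} (A : Lifted.Arc a a allLabels) →
                               aff 0ᵥ ∈ map Lifted.point (Lifted.steps A) → ContainsZero 𝔽 n (liftedCycle A)
    liftedCycle-containsZero A = Lifted.universalCycle-containsZero (AllLines 𝔽 n D) allLabels allLabels-unique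
      lineOf-injective lineOf-sound lineOf-complete (Lifted.steps A) (Lifted.arc-closed A) (Lifted.labels A)

    shiftStep : Point → Base.Step → Lifted.Step
    shiftStep t (a , i) = shiftPG t a , (t , i)

    start-shift : ∀ t xs s → Lifted.start (map (shiftStep t) xs) (shiftPG t s) ≡ shiftPG t (Base.start xs s)
    start-shift t []      s = refl
    start-shift t (_ ∷ _) s = refl

    walk-shift : ∀ t {xs s} → Base.Walk xs s → Lifted.Walk (map (shiftStep t) xs) (shiftPG t s)
    walk-shift t                 Base.[]      = Lifted.[]
    walk-shift t {(a , i) ∷ xs} {s} (r Base.∷ w) =
      subst (Lifted.Window (shiftStep t (a , i))) (sym (start-shift t xs s)) (represents-shift t r)
      Lifted.∷ walk-shift t w

    arc-shift : ∀ t {a b ls} → Base.Arc a b ls → Lifted.Arc (shiftPG t a) (shiftPG t b) (map (t ,_) ls)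
    arc-shift t {b = b} A = record
      { steps  = map (shiftStep t) (Base.steps A)
      ; walk   = walk-shift t (Base.walk A)
      ; starts = trans (start-shift t (Base.steps A) b) (cong (shiftPG t) (Base.starts A))
      ; labels = ↭-trans (↭-reflexive (trans (sym (Listₚ.map-∘ (Base.steps A))) (Listₚ.map-∘ (Base.steps A))))
                         (Permutationₚ.map⁺ (t ,_) (Base.labels A))
      }

    record TourThroughOrigin (ls : List Label) : Set where
      constructor tourThroughOrigin
      field
        {endpoint} : PG
        arc     : Lifted.Arc endpoint endpoint ls
        through-origin : aff 0ᵥ ∈ map Lifted.point (Lifted.steps arc)

    cycleThroughOrigin : TourThroughOrigin allLabels → Σ (UniversalCycle 𝔽 n (AllLines 𝔽 n D)) (ContainsZero 𝔽 n)
    cycleThroughOrigin (tourThroughOrigin A 0∈) = liftedCycle A , liftedCycle-containsZero A 0∈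

  module ViaInfinity {d l₀ x₁ l₁ rest} (closed : Base.ClosedWalk ((inf d , l₀) ∷ (aff x₁ , l₁) ∷ rest))
                    (labels : map Base.label ((inf d , l₀) ∷ (aff x₁ , l₁) ∷ rest) ↭ allFin N) where

    open Lift (neg x₁)

    copies : ∀ ts → Lifted.Arc (inf d) (inf d) (cartesianProduct ts (allFin N))
    copies []       = Lifted.emptyArc
    copies (t ∷ ts) = arc-shift t (Base.arc-relabel labels (Base.closedWalk⇒arc _ _ closed)) Lifted.⨾ copies ts

    tour : TourThroughOrigin allLabels
    tour = tourThroughOrigin (copies (representatives (neg x₁))) (there (here (sym (shiftPG-neg x₁))))

  record IsAffineCycle (V : List (Point × Fin N)) : Set where
    field
      closed : Base.ClosedWalk (Base.affine V)
      labels : Base.labelsᴬ V ↭ allFin N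

  open IsAffineCycle

  isAffineCycle-rotate : ∀ V W → IsAffineCycle (V ++ W) → IsAffineCycle (W ++ V)
  isAffineCycle-rotate V W C = record
    { closed = Base.closedWalkᴬ-rotate V W (closed C)
    ; labels = ↭-trans (Permutationₚ.map⁺ proj₂ (Permutationₚ.++-comm W V)) (labels C)
    }

  module AffineCase (x₁ : Point) where

    t₀ : Point
    t₀ = neg x₁

    open Lift t₀
    open Base using (atInfinityOf)

    forward : ∀ {x₀ l₀} M {xₗ lₗ} → IsAffineCycle ((x₀ , l₀) ∷ M ∷ʳ (xₗ , lₗ)) →
              ∀ t → Lifted.Arc (atInfinityOf l₀) (atInfinityOf lₗ) (labelsOf t)
    forward M C t = arc-shift t (Base.arc-relabel (labels C) (Base.openArc M (closed C)))

    backward : ∀ {x₀ l₀} M {xₗ lₗ} → IsAffineCycle ((x₀ , l₀) ∷ M ∷ʳ (xₗ , lₗ)) →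
               ∀ t → Lifted.Arc (atInfinityOf lₗ) (atInfinityOf l₀) (labelsOf t)
    backward M C t = arc-shift t (Base.arc-relabel (labels C) (Base.reverseArc M (closed C)))

    pairedCopies : ∀ {x₀ l₀} M {xₗ lₗ} → IsAffineCycle ((x₀ , l₀) ∷ M ∷ʳ (xₗ , lₗ)) →
                   ∀ {ts} → Even ts → Lifted.Arc (atInfinityOf l₀) (atInfinityOf l₀) (cartesianProduct ts (allFin N))
    pairedCopies M C []                     = Lifted.emptyArc
    pairedCopies M C (pair {a} {b} ts-even) =
      forward M C a Lifted.⨾ backward M C b Lifted.⨾ pairedCopies M C ts-even

    -- For N = 3, three copies opened at the lines l₀, lₗ and l₁ in turn close up. For N ≥ 4, the copy translated
    -- by t₀ is cut after its second window, a backward copy bridges the points at infinity of l₁ and l₂ in between,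
    -- and a second backward copy leads back from the point at infinity of lₗ to that of l₀.
    threeCopies : ∀ {x₀ l₀ l₁} M {xₗ lₗ} → IsAffineCycle ((x₀ , l₀) ∷ (x₁ , l₁) ∷ M ∷ʳ (xₗ , lₗ)) → ∀ a b →
                  Lifted.Arc (atInfinityOf l₀) (atInfinityOf l₀) (labelsOf t₀ ++ (labelsOf a ++ labelsOf b))
    threeCopies {x₀} {l₀} {l₁} [] {xₗ} {lₗ} C a b =
      forward ((x₁ , l₁) ∷ []) C t₀
      Lifted.⨾ forward ((x₀ , l₀) ∷ []) (isAffineCycle-rotate ((x₀ , l₀) ∷ (x₁ , l₁) ∷ []) ((xₗ , lₗ) ∷ []) C) a
      Lifted.⨾ forward ((xₗ , lₗ) ∷ []) (isAffineCycle-rotate ((x₀ , l₀) ∷ []) ((x₁ , l₁) ∷ (xₗ , lₗ) ∷ []) C) b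
    threeCopies {x₀} {l₀} {l₁} ((x₂ , l₂) ∷ M) {xₗ} {lₗ} C a b = Lifted.arc-relabel relabel
      (arc-shift t₀ (Base.openArc [] (proj₁ split))
       Lifted.⨾ backward (M ∷ʳ (xₗ , lₗ) ∷ʳ (x₀ , l₀)) rotated a
       Lifted.⨾ arc-shift t₀ (Base.openArc M (proj₂ split))
       Lifted.⨾ backward ((x₁ , l₁) ∷ (x₂ , l₂) ∷ M) C b)
      where
      R = (x₂ , l₂) ∷ M ∷ʳ (xₗ , lₗ)
      split = Base.walk-++⁻ (Base.affine ((x₀ , l₀) ∷ (x₁ , l₁) ∷ [])) (closed C)
      rotated : IsAffineCycle ((x₂ , l₂) ∷ M ∷ʳ (xₗ , lₗ) ∷ʳ (x₀ , l₀) ∷ʳ (x₁ , l₁))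
      rotated = subst IsAffineCycle
        (cong ((x₂ , l₂) ∷_) (sym (Listₚ.++-assoc (M ∷ʳ (xₗ , lₗ)) [ (x₀ , l₀) ] [ (x₁ , l₁) ])))
        (isAffineCycle-rotate ((x₀ , l₀) ∷ (x₁ , l₁) ∷ []) R C)
      relabel : map (t₀ ,_) (l₀ ∷ l₁ ∷ []) ++ (labelsOf a ++ (map (t₀ ,_) (Base.labelsᴬ R) ++ labelsOf b))
                ↭ labelsOf t₀ ++ (labelsOf a ++ labelsOf b)
      relabel = ↭-trans
        (++-interchange-↭ (map (t₀ ,_) (l₀ ∷ l₁ ∷ [])) (labelsOf a) (map (t₀ ,_) (Base.labelsᴬ R)) (labelsOf b))
        (Permutationₚ.++⁺ʳ (labelsOf a ++ labelsOf b) (Permutationₚ.map⁺ (t₀ ,_) (labels C)))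

    threeCopies-through-origin : ∀ {x₀ l₀ l₁} M {xₗ lₗ} (C : IsAffineCycle ((x₀ , l₀) ∷ (x₁ , l₁) ∷ M ∷ʳ (xₗ , lₗ))) →
                                 ∀ a b → aff 0ᵥ ∈ map Lifted.point (Lifted.steps (threeCopies M C a b))
    threeCopies-through-origin []      C a b = there (here (sym (shiftPG-neg x₁)))
    threeCopies-through-origin (_ ∷ _) C a b = there (here (sym (shiftPG-neg x₁)))

    tour : ∀ {x₀ l₀ l₁} M {xₗ lₗ} → IsAffineCycle ((x₀ , l₀) ∷ (x₁ , l₁) ∷ M ∷ʳ (xₗ , lₗ)) →
           ∀ {ts} → Parity ts → TourThroughOrigin (cartesianProduct (t₀ ∷ ts) (allFin N))
    tour {x₀} {l₀} {l₁} M {xₗ} {lₗ} C (even []) = tourThroughOrigin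
      (Lifted.arc-relabel (↭-reflexive (sym (Listₚ.++-identityʳ (labelsOf t₀)))) (arc-shift t₀ single))
      (there (here (sym (shiftPG-neg x₁))))
      where
      single = Base.arc-relabel (labels C) (Base.closedWalkᴬ⇒arc x₀ l₀ ((x₁ , l₁) ∷ M ∷ʳ (xₗ , lₗ)) (closed C))
    tour {l₁ = l₁} M C (even (pair {a} {b} {ts} ts-even)) = tourThroughOrigin
      (Lifted.arc-relabel (↭-reflexive reassociate) (threeCopies M C a b Lifted.⨾ rest))
      (Lifted.∈-points-⨾ˡ (threeCopies M C a b) rest (threeCopies-through-origin M C a b))
      where
      rest = pairedCopies ((x₁ , l₁) ∷ M) C ts-even
      reassociate : (labelsOf t₀ ++ (labelsOf a ++ labelsOf b)) ++ cartesianProduct ts (allFin N)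
                    ≡ cartesianProduct (t₀ ∷ a ∷ b ∷ ts) (allFin N)
      reassociate = trans (Listₚ.++-assoc (labelsOf t₀) _ _) (cong (labelsOf t₀ ++_) (Listₚ.++-assoc (labelsOf a) _ _))
    tour {l₁ = l₁} M C (odd ts-even) =
      tourThroughOrigin (pairedCopies ((x₁ , l₁) ∷ M) C (pair ts-even)) (there (here (sym (shiftPG-neg x₁))))

  data Shape : Set where
    empty      : N ≡ 0 → Shape
    viaInfinity : ∀ {d l₀ x₁ l₁ rest} → Base.ClosedWalk ((inf d , l₀) ∷ (aff x₁ , l₁) ∷ rest) →
                 map Base.label ((inf d , l₀) ∷ (aff x₁ , l₁) ∷ rest) ↭ allFin N → Shape
    allAffine  : ∀ {x₀ l₀ x₁ l₁} M {xₗ lₗ} → IsAffineCycle ((x₀ , l₀) ∷ (x₁ , l₁) ∷ M ∷ʳ (xₗ , lₗ)) → Shape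

  infiniteShape : ∀ {d l} ys → Base.ClosedWalk ((inf d , l) ∷ ys) →
                  map Base.label ((inf d , l) ∷ ys) ↭ allFin N → Shape
  infiniteShape []                (() Base.∷ _)
  infiniteShape ((inf _ , _) ∷ _) (() Base.∷ _)
  infiniteShape ((aff _ , _) ∷ _) closed labels = viaInfinity closed labels

  no-2-cycle : ∀ {x₀ l₀ x₁ l₁} → ¬ IsAffineCycle ((x₀ , l₀) ∷ (x₁ , l₁) ∷ [])
  no-2-cycle C with closed C | Permutationₛ.Unique-resp-↭ (setoid _) (↭⇒↭ₛ (↭-sym (labels C))) (allFin⁺ N)
  ... | r₀ Base.∷ r₁ Base.∷ Base.[] | (l₀≢l₁ ∷ []) ∷ _ =
    l₀≢l₁ (distinct _ _ (represents-unique r₀ (represents-sym r₁)))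

  affineShape : ∀ V → IsAffineCycle V → Shape
  affineShape [] C = empty (sym (trans (Permutationₚ.↭-length (labels C)) (Listₚ.length-tabulate id)))
  affineShape (_ ∷ []) C with closed C
  ... | r Base.∷ Base.[] = ⊥-elim (represents-irrefl r)
  affineShape ((x₀ , l₀) ∷ (x₁ , l₁) ∷ R) C with initLast R
  ... | []              = ⊥-elim (no-2-cycle C)
  ... | M ∷ʳ′ (xₗ , lₗ) = allAffine M C

  shape : Shape
  shape with Base.affineOrInfinite baseWalk
  ... | inj₁ (V , walk≡) = affineShape V record
    { closed = subst Base.ClosedWalk walk≡ baseWalk-closed
    ; labels = subst (_↭ allFin N) (trans (cong (map Base.label) walk≡) (Base.label-affine V)) baseWalk-labels
    }
  ... | inj₂ (P , d , l , Q , walk≡) = infiniteShape (Q ++ P)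
    (Base.closedWalk-rotate P ((inf d , l) ∷ Q) (subst Base.ClosedWalk walk≡ baseWalk-closed))
    (↭-trans (Permutationₚ.map⁺ Base.label (Permutationₚ.++-comm ((inf d , l) ∷ Q) P))
             (subst (λ xs → map Base.label xs ↭ allFin N) walk≡ baseWalk-labels))

  liftCycle : Σ (UniversalCycle 𝔽 n (AllLines 𝔽 n D)) (λ C → ContainsZero 𝔽 n CU → ContainsZero 𝔽 n C)
  liftCycle with shape
  ... | empty N≡0 = emptyCycle N≡0 , λ { (i , _) → ⊥-elim (N≡0⇒¬Fin N≡0 i) }
  ... | viaInfinity {x₁ = x₁} closed labels =
    map₂ const (Lift.cycleThroughOrigin (neg x₁) (ViaInfinity.tour closed labels))
  ... | allAffine {x₁ = x₁} M C =
    map₂ const (Lift.cycleThroughOrigin (neg x₁) (AffineCase.tour x₁ M C (parity (otherRepresentatives (neg x₁)))))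

mainTheorem2 : ∀ {q : ℕ} (𝔽 : FiniteField q) (n : ℕ) → 1 ≤ n → IsPrimePower q
    → (U : Pt 𝔽 n → Set) → IsSubspace 𝔽 n U → DimLess 𝔽 n U
    → (D : Dir 𝔽 n → Set) → (∀ d → D d → SpanIn 𝔽 n d U)
    → (CU : UniversalCycle 𝔽 n (LinesIn 𝔽 n U D))
    → Σ (UniversalCycle 𝔽 n (AllLines 𝔽 n D))
        (λ C → ContainsZero 𝔽 n CU → ContainsZero 𝔽 n C)
mainTheorem2 𝔽 n _ _ U U-subspace (_ , _ , basis) D D⊆U CU =
  Lifting.liftCycle 𝔽 n U U-subspace (Finite.span-decidable 𝔽 basis) D D⊆U CU
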